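{- Let $n\in\mathbb{N}^*$, let $\mathcal{A}_1,\ldots,\mathcal{A}_n$ be non-empty algebras in $\mathcal{C}$, and let $\mathcal{A}=\prod_{i=1}^n\mathcal{A}_i$. Then $\mathcal{A}$ satisfies $(\star)$ iff $\mathcal{A}_i$ satisfies $(\star)$ for every $i\in\{1,\ldots,n\}$.
   Context: $\mathcal{C}$ is an equational class of congruence-distributive algebras of some signature, such that every non-empty algebra $\mathcal{A}$ in $\mathcal{C}$ satisfies (H): $\nabla_{\mathcal{A}}=A^2$ is compact in the congruence lattice ${\rm Con}(\mathcal{A})$. Direct products carry componentwise operations. $\mathcal{K}(\mathcal{A})$ is the set of finitely generated congruences; $\mathcal{B}(L)$ is the Boolean center of a bounded distributive lattice $L$; ${\rm Rad}(\mathcal{A})$ is the intersection of all maximal congruences. An algebra $\mathcal{A}$ satisfies $(\star)$ iff for every $\theta\in{\rm Con}(\mathcal{A})$ there exist $\alpha\in\mathcal{K}(\mathcal{A})$ and $\beta\in\mathcal{B}({\rm Con}(\mathcal{A}))$ with $\alpha\subseteq{\rm Rad}(\mathcal{A})$ and $\theta=\alpha\vee\beta$. -}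

module Defs where

open import Data.Nat using (ℕ)
open import Data.Fin using (Fin)
open import Data.Product using (Σ; ∃; _×_; _,_)
open import Data.Sum using (_⊎_)
open import Data.Unit using (⊤)
open import Data.List using (List)
open import Data.List.Membership.Propositional using (_∈_)
open import Relation.Binary using (IsEquivalence)
open import Relation.Nullary using (¬_)

-- Algebras are setoid-based: the carrier comes with an equality _≈_
-- (the identity congruence Δ), and operations respect it.  This is the
-- standard way to have componentwise direct products without funext.

record Signature : Set₁ where
  field
    Op    : Set
    arity : Op → ℕ

module _ (𝑆 : Signature) where
  open Signature 𝑆

  record Algebra : Set₁ where
    field
      Carrier       : Set
      _≈_           : Carrier → Carrier → Set
      isEquivalence : IsEquivalence _≈_
      op            : (f : Op) → (Fin (arity f) → Carrier) → Carrier
      op-cong       : ∀ f {xs ys : Fin (arity f) → Carrier} →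
                      (∀ i → xs i ≈ ys i) → op f xs ≈ op f ys

  data Term : Set where
    var : ℕ → Term
    app : (f : Op) → (Fin (arity f) → Term) → Term

module _ {𝑆 : Signature} where
  open Signature 𝑆

  module _ (A : Algebra 𝑆) where
    open Algebra A

    BRel : Set₁
    BRel = Carrier → Carrier → Set

    Δ : BRel
    Δ = _≈_

    ∇ : BRel
    ∇ = λ _ _ → ⊤

    record IsCongruence (θ : BRel) : Set where
      field
        reflexive  : ∀ {a b} → a ≈ b → θ a b
        sym        : ∀ {a b} → θ a b → θ b a
        trans      : ∀ {a b c} → θ a b → θ b c → θ a c
        compatible : ∀ f {xs ys : Fin (arity f) → Carrier} →
                     (∀ i → θ (xs i) (ys i)) → θ (op f xs) (op f ys)

    data Cg (R : BRel) : BRel where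
      base : ∀ {a b} → R a b → Cg R a b
      eq   : ∀ {a b} → a ≈ b → Cg R a b
      symm : ∀ {a b} → Cg R a b → Cg R b a
      tran : ∀ {a b c} → Cg R a b → Cg R b c → Cg R a c
      comp : ∀ f {xs ys : Fin (arity f) → Carrier} →
             (∀ i → Cg R (xs i) (ys i)) → Cg R (op f xs) (op f ys)

    _∧_ : BRel → BRel → BRel
    (θ ∧ ψ) a b = θ a b × ψ a b

    _∨_ : BRel → BRel → BRel
    θ ∨ ψ = Cg (λ a b → θ a b ⊎ ψ a b)

    ⋁ : {I : Set} → (I → BRel) → BRel
    ⋁ {I} φ = Cg (λ a b → Σ I (λ i → φ i a b))

    ⋁fin : {I : Set} → (I → BRel) → List I → BRel
    ⋁fin {I} φ is = Cg (λ a b → Σ I (λ i → (i ∈ is) × φ i a b))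

    _⊆_ : BRel → BRel → Set
    θ ⊆ ψ = ∀ {a b} → θ a b → ψ a b

    _≐_ : BRel → BRel → Set
    θ ≐ ψ = (θ ⊆ ψ) × (ψ ⊆ θ)

    Compact : BRel → Set₁
    Compact θ = (I : Set) (φ : I → BRel) → (∀ i → IsCongruence (φ i)) →
                θ ⊆ ⋁ φ → Σ (List I) (λ is → θ ⊆ ⋁fin φ is)

    FinGen : BRel → Set
    FinGen α = Σ (List (Carrier × Carrier)) (λ ps → α ≐ Cg (λ a b → (a , b) ∈ ps))

    InBooleanCenter : BRel → Set₁
    InBooleanCenter β = IsCongruence β ×
      Σ BRel (λ γ → IsCongruence γ × ((β ∧ γ) ≐ Δ) × ((β ∨ γ) ≐ ∇))

    IsMaximal : BRel → Set₁
    IsMaximal θ = IsCongruence θ × ¬ (∇ ⊆ θ) ×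
      ((ψ : BRel) → IsCongruence ψ → θ ⊆ ψ → ¬ (∇ ⊆ ψ) → ψ ⊆ θ)

    Rad : Carrier → Carrier → Set₁
    Rad a b = (θ : BRel) → IsMaximal θ → θ a b

    Star : Set₁
    Star = (θ : BRel) → IsCongruence θ →
      Σ BRel (λ α → Σ BRel (λ β →
        IsCongruence α × FinGen α × (∀ {a b} → α a b → Rad a b) ×
        InBooleanCenter β × (θ ≐ (α ∨ β))))

    NonEmpty : Set
    NonEmpty = Carrier

    CongruenceDistributive : Set₁
    CongruenceDistributive = (θ ψ χ : BRel) →
      IsCongruence θ → IsCongruence ψ → IsCongruence χ →
      (θ ∧ (ψ ∨ χ)) ≐ ((θ ∧ ψ) ∨ (θ ∧ χ))

    eval : (ℕ → Carrier) → Term 𝑆 → Carrier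
    eval ρ (var x)    = ρ x
    eval ρ (app f ts) = op f (λ i → eval ρ (ts i))

    Satisfies : Term 𝑆 → Term 𝑆 → Set
    Satisfies s t = (ρ : ℕ → Carrier) → eval ρ s ≈ eval ρ t

  InClass : (Term 𝑆 → Term 𝑆 → Set) → Algebra 𝑆 → Set
  InClass E A = ∀ s t → E s t → Satisfies A s t

  Π : {n : ℕ} → (Fin n → Algebra 𝑆) → Algebra 𝑆
  Π {n} A = record
    { Carrier       = (i : Fin n) → Algebra.Carrier (A i)
    ; _≈_           = λ x y → ∀ i → Algebra._≈_ (A i) (x i) (y i)
    ; isEquivalence = record
        { refl  = λ i → IsEquivalence.refl (Algebra.isEquivalence (A i))
        ; sym   = λ p i → IsEquivalence.sym (Algebra.isEquivalence (A i)) (p i)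
        ; trans = λ p q i → IsEquivalence.trans (Algebra.isEquivalence (A i)) (p i) (q i)
        }
    ; op            = λ f xs i → Algebra.op (A i) f (λ k → xs k i)
    ; op-cong       = λ f p i → Algebra.op-cong (A i) f (λ k → p k i)
    }

module Submission where

-- Fix a point e of P and let inject i c be e with its i-th coordinate
-- replaced by c.  A congruence θ of P induces on each factor the
-- congruence restrict θ i = (θ ∨ ker πᵢ) read through inject i; it is
-- Galois-adjoint to the preimage lift i under the projection πᵢ.
-- Congruence distributivity makes every θ the product of its restrictions
-- (θ = ⋀ᵢ (θ ∨ ker πᵢ), since ⋀ᵢ ker πᵢ = Δ).  Hence all ingredients of
-- (⋆) transfer in both directions: finitely generated congruences, the
-- Boolean center, and the radical -- maximal congruences of a factor lift
-- to maximal congruences of P and conversely.  Everything is constructive;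
-- the only classical step ("restrict M i is maximal or total") is made
-- under a double negation, which compactness of ∇ removes, because
-- maximal congruences are then ¬¬-stable.

open import Defs
open import Data.Nat using (ℕ; _≤_)
open import Data.Fin using (Fin; zero; suc)
open import Data.Product using (_×_; _,_; proj₁; proj₂)
open import Data.Sum using (_⊎_; inj₁; inj₂)
open import Data.Unit using (tt)
open import Data.List using (List; []; _∷_; allFin; map; concatMap)
open import Data.List.Membership.Propositional using (_∈_; find; lose)
open import Data.List.Membership.Propositional.Properties
  using (∈-allFin; ∈-map⁺; ∈-map⁻; ∈-concatMap⁺; ∈-concatMap⁻)
open import Data.List.Relation.Unary.Any using (here; there)
import Data.List.Relation.Unary.All as All
open import Effect.Monad using (RawMonad)
open import Relation.Binary using (IsEquivalence)
open import Relation.Nullary using (¬_)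
open import Relation.Nullary.Negation using (¬¬-Monad; ¬¬-map)
open import Relation.Binary.PropositionalEquality using (_≡_; refl)
open import Function.Bundles using (_⇔_; mk⇔)

¬¬-∀∈ : {X : Set} {Q : X → Set} {L : List X} →
        (∀ x → x ∈ L → ¬ ¬ Q x) → ¬ ¬ (∀ x → x ∈ L → Q x)
¬¬-∀∈ h = ¬¬-map (λ all _ m → All.lookup all m)
  (All.sequenceA _ (RawMonad.rawApplicative ¬¬-Monad) (All.tabulate (λ {x} m → h x m)))

¬¬-∀Fin : ∀ {m} {Q : Fin m → Set} → (∀ i → ¬ ¬ Q i) → ¬ ¬ (∀ i → Q i)
¬¬-∀Fin h = ¬¬-map (λ all i → all i (∈-allFin i)) (¬¬-∀∈ (λ i _ → h i))

module Congruences {𝑆 : Signature} (A : Algebra 𝑆) where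
  open Algebra A

  ≡⇒≈ : ∀ {a b} → a ≡ b → a ≈ b
  ≡⇒≈ refl = IsEquivalence.refl isEquivalence

  Δ-isCongruence : IsCongruence A (Δ A)
  Δ-isCongruence = record
    { reflexive  = λ p → p
    ; sym        = IsEquivalence.sym isEquivalence
    ; trans      = IsEquivalence.trans isEquivalence
    ; compatible = op-cong
    }

  Cg-isCongruence : (R : BRel A) → IsCongruence A (Cg A R)
  Cg-isCongruence R = record { reflexive = eq ; sym = symm ; trans = tran ; compatible = comp }

  Cg-least : {R θ : BRel A} → IsCongruence A θ → (∀ {a b} → R a b → θ a b) → _⊆_ A (Cg A R) θ
  Cg-least cθ h (base r)    = h r
  Cg-least cθ h (eq p)      = IsCongruence.reflexive cθ p
  Cg-least cθ h (symm p)    = IsCongruence.sym cθ (Cg-least cθ h p)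
  Cg-least cθ h (tran p q)  = IsCongruence.trans cθ (Cg-least cθ h p) (Cg-least cθ h q)
  Cg-least cθ h (comp f ps) = IsCongruence.compatible cθ f (λ k → Cg-least cθ h (ps k))

  ∨-least : {θ ψ χ : BRel A} → IsCongruence A χ →
            _⊆_ A θ χ → _⊆_ A ψ χ → _⊆_ A (_∨_ A θ ψ) χ
  ∨-least {θ} {ψ} {χ} cχ θ⊆χ ψ⊆χ = Cg-least cχ either
    where either : ∀ {a b} → θ a b ⊎ ψ a b → χ a b
          either (inj₁ t) = θ⊆χ t
          either (inj₂ s) = ψ⊆χ s

  ∨-mono : {θ θ′ ψ ψ′ : BRel A} → _⊆_ A θ θ′ → _⊆_ A ψ ψ′ → _⊆_ A (_∨_ A θ ψ) (_∨_ A θ′ ψ′)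
  ∨-mono θ⊆θ′ ψ⊆ψ′ = ∨-least (Cg-isCongruence _) (λ t → base (inj₁ (θ⊆θ′ t))) (λ s → base (inj₂ (ψ⊆ψ′ s)))

  ∧-isCongruence : {θ ψ : BRel A} → IsCongruence A θ → IsCongruence A ψ → IsCongruence A (_∧_ A θ ψ)
  ∧-isCongruence cθ cψ = record
    { reflexive  = λ p → IsCongruence.reflexive cθ p , IsCongruence.reflexive cψ p
    ; sym        = λ (t , s) → IsCongruence.sym cθ t , IsCongruence.sym cψ s
    ; trans      = λ (t , s) (t′ , s′) → IsCongruence.trans cθ t t′ , IsCongruence.trans cψ s s′
    ; compatible = λ f ps → IsCongruence.compatible cθ f (λ k → proj₁ (ps k))
                          , IsCongruence.compatible cψ f (λ k → proj₂ (ps k))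
    }

  ⋀ : {I : Set} → (I → BRel A) → List I → BRel A
  ⋀ ψ L a b = ∀ j → j ∈ L → ψ j a b

  ⋀-isCongruence : {I : Set} {ψ : I → BRel A} → (∀ j → IsCongruence A (ψ j)) →
                   (L : List I) → IsCongruence A (⋀ ψ L)
  ⋀-isCongruence cψ L = record
    { reflexive  = λ p j _ → IsCongruence.reflexive (cψ j) p
    ; sym        = λ t j m → IsCongruence.sym (cψ j) (t j m)
    ; trans      = λ t s j m → IsCongruence.trans (cψ j) (t j m) (s j m)
    ; compatible = λ f ps j m → IsCongruence.compatible (cψ j) f (λ k → ps k j m)
    }

  module Distributive (cd : CongruenceDistributive A) where

    ∨-distribˡ-∧ : {θ ψ χ : BRel A} → IsCongruence A θ → IsCongruence A ψ → IsCongruence A χ →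
                   _⊆_ A (_∧_ A (_∨_ A θ ψ) (_∨_ A θ χ)) (_∨_ A θ (_∧_ A ψ χ))
    ∨-distribˡ-∧ {θ} {ψ} {χ} cθ cψ cχ p =
      ∨-least target-congruence (λ (_ , t) → base (inj₁ t)) χ∧θ∨ψ⊆target
        (proj₁ (cd (_∨_ A θ ψ) θ χ (Cg-isCongruence _) cθ cχ) p)
      where
      target-congruence : IsCongruence A (_∨_ A θ (_∧_ A ψ χ))
      target-congruence = Cg-isCongruence _
      -- χ ∧ (θ ∨ ψ) = (χ ∧ θ) ∨ (χ ∧ ψ) ⊆ θ ∨ (ψ ∧ χ)
      χ∧θ∨ψ⊆target : _⊆_ A (_∧_ A (_∨_ A θ ψ) χ) (_∨_ A θ (_∧_ A ψ χ))
      χ∧θ∨ψ⊆target (s , c) =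
        ∨-mono proj₂ (λ (c′ , s′) → s′ , c′) (proj₁ (cd χ θ ψ cχ cθ cψ) (c , s))

    ∨-distribˡ-⋀ : {I : Set} {θ : BRel A} {ψ : I → BRel A} →
                   IsCongruence A θ → (∀ j → IsCongruence A (ψ j)) → (L : List I) →
                   _⊆_ A (⋀ (λ j → _∨_ A θ (ψ j)) L) (_∨_ A θ (⋀ ψ L))
    ∨-distribˡ-⋀ cθ cψ []      _ = base (inj₂ (λ j ()))
    ∨-distribˡ-⋀ cθ cψ (j ∷ L) p =
      ∨-mono (λ t → t) (λ (s , ss) → λ { _ (here refl) → s ; k (there m) → ss k m })
        (∨-distribˡ-∧ cθ (cψ j) (⋀-isCongruence cψ L)
          (p j (here refl) , ∨-distribˡ-⋀ cθ cψ L (λ k m → p k (there m))))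

  Proper : BRel A → Set
  Proper θ = ¬ (_⊆_ A (∇ A) θ)

  ¬¬-isCongruence : {θ : BRel A} → IsCongruence A θ → IsCongruence A (λ a b → ¬ ¬ θ a b)
  ¬¬-isCongruence cθ = record
    { reflexive  = λ p k → k (IsCongruence.reflexive cθ p)
    ; sym        = ¬¬-map (IsCongruence.sym cθ)
    ; trans      = λ t s k → t (λ t′ → s (λ s′ → k (IsCongruence.trans cθ t′ s′)))
    ; compatible = λ f ps → ¬¬-map (IsCongruence.compatible cθ f) (¬¬-∀Fin ps)
    }

  -- With ∇ compact, maximal congruences are ¬¬-stable: ¬¬ M is a
  -- congruence above M, and it is proper because a cover of ∇ by
  -- principal congruences has a finite subcover.
  module Compactness (compact : Compact A (∇ A)) where

    principal : Carrier × Carrier → BRel A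
    principal p = Cg A (λ a b → (a , b) ≡ p)

    ¬¬-total : {θ : BRel A} → IsCongruence A θ →
               (∀ a b → ¬ ¬ θ a b) → ¬ ¬ (_⊆_ A (∇ A) θ)
    ¬¬-total {θ} cθ h with compact (Carrier × Carrier) principal (λ _ → Cg-isCongruence _)
                                   (λ {a} {b} _ → base ((a , b) , base refl))
    ... | ps , ∇⊆⋁ps = ¬¬-map total (¬¬-∀∈ (λ (a , b) _ → h a b))
      where
      total : (∀ p → p ∈ ps → θ (proj₁ p) (proj₂ p)) → _⊆_ A (∇ A) θ
      total θps _ = Cg-least cθ (λ (p , m , t) → Cg-least cθ (λ { refl → θps p m }) t) (∇⊆⋁ps tt)

    maximal-¬¬-stable : {M : BRel A} → IsMaximal A M → ∀ {a b} → ¬ ¬ M a b → M a b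
    maximal-¬¬-stable (cM , proper , maximal) =
      maximal _ (¬¬-isCongruence cM) (λ m k → k m)
        (λ ∇⊆¬¬M → ¬¬-total cM (λ a b → ∇⊆¬¬M {a} {b} tt) proper)

  record ⋆-Decomposition (θ : BRel A) : Set₁ where
    field
      α β          : BRel A
      α-congruence : IsCongruence A α
      α-finGen     : FinGen A α
      α-radical    : ∀ {a b} → α a b → Rad A a b
      β-central    : InBooleanCenter A β
      θ≐α∨β        : _≐_ A θ (_∨_ A α β)

  ⋆-decomposition : Star A → ∀ {θ} → IsCongruence A θ → ⋆-Decomposition θ
  ⋆-decomposition star cθ with star _ cθ
  ... | α , β , cα , fα , rα , bβ , θ≐ = record
    { α = α ; β = β ; α-congruence = cα ; α-finGen = fα ; α-radical = rα ; β-central = bβ ; θ≐α∨β = θ≐ }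

  Star-intro : (∀ {θ} → IsCongruence A θ → ⋆-Decomposition θ) → Star A
  Star-intro decompose θ cθ = α , β , α-congruence , α-finGen , α-radical , β-central , θ≐α∨β
    where open ⋆-Decomposition (decompose cθ)

update : ∀ {n} {C : Fin n → Set} → ((j : Fin n) → C j) → (i : Fin n) → C i → (j : Fin n) → C j
update z zero    c zero    = c
update z zero    c (suc j) = z (suc j)
update z (suc i) c zero    = z zero
update z (suc i) c (suc j) = update (λ k → z (suc k)) i c j

update-same : ∀ {n} {C : Fin n → Set} (z : (j : Fin n) → C j) (i : Fin n) (c : C i) →
              update z i c i ≡ c
update-same z zero    c = refl
update-same z (suc i) c = update-same (λ k → z (suc k)) i c

update-related : ∀ {n} {C : Fin n → Set} (Q : (j : Fin n) → C j → C j → Set)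
                 (z : (j : Fin n) → C j) (i : Fin n) {c d : C i} →
                 (∀ j → Q j (z j) (z j)) → Q i c d →
                 ∀ j → Q j (update z i c j) (update z i d j)
update-related Q z zero    refl-z q zero    = q
update-related Q z zero    refl-z q (suc j) = refl-z (suc j)
update-related Q z (suc i) refl-z q zero    = refl-z zero
update-related Q z (suc i) refl-z q (suc j) =
  update-related (λ k → Q (suc k)) (λ k → z (suc k)) i (λ k → refl-z (suc k)) q j

eval-Π : ∀ {𝑆 : Signature} {n : ℕ} (A : Fin n → Algebra 𝑆)
         (ρ : ℕ → Algebra.Carrier (Π A)) (t : Term 𝑆) (i : Fin n) →
         Algebra._≈_ (A i) (eval (Π A) ρ t i) (eval (A i) (λ x → ρ x i) t)
eval-Π A ρ (var x)    i = IsEquivalence.refl (Algebra.isEquivalence (A i))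
eval-Π A ρ (app f ts) i = Algebra.op-cong (A i) f (λ k → eval-Π A ρ (ts k) i)

Π-InClass : ∀ {𝑆 : Signature} {n : ℕ} (E : Term 𝑆 → Term 𝑆 → Set) (A : Fin n → Algebra 𝑆) →
            (∀ i → InClass E (A i)) → InClass E (Π A)
Π-InClass E A A∈E s t s≈t ρ i =
  trans (eval-Π A ρ s i) (trans (A∈E i s t s≈t (λ x → ρ x i)) (sym (eval-Π A ρ t i)))
  where open IsEquivalence (Algebra.isEquivalence (A i))

module Product {𝑆 : Signature} {n : ℕ} (A : Fin n → Algebra 𝑆)
               (e : (i : Fin n) → Algebra.Carrier (A i)) where
  open Signature 𝑆
  open Congruences using (≡⇒≈; Δ-isCongruence; Cg-isCongruence; Cg-least; ∨-least; ∨-mono; ∧-isCongruence; Proper)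

  P : Algebra 𝑆
  P = Π A

  private
    module Eq (i : Fin n) = IsEquivalence (Algebra.isEquivalence (A i))

  lift : (i : Fin n) → BRel (A i) → BRel P
  lift i ψ x y = ψ (x i) (y i)

  ker : Fin n → BRel P
  ker i = lift i (Δ (A i))

  prod : ((i : Fin n) → BRel (A i)) → BRel P
  prod ψs x y = ∀ i → ψs i (x i) (y i)

  lift-isCongruence : ∀ i {ψ} → IsCongruence (A i) ψ → IsCongruence P (lift i ψ)
  lift-isCongruence i cψ = record
    { reflexive  = λ p → IsCongruence.reflexive cψ (p i)
    ; sym        = IsCongruence.sym cψ
    ; trans      = IsCongruence.trans cψ
    ; compatible = λ f ps → IsCongruence.compatible cψ f ps
    }

  prod-isCongruence : ∀ {ψs} → (∀ i → IsCongruence (A i) (ψs i)) → IsCongruence P (prod ψs)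
  prod-isCongruence cψs = record
    { reflexive  = λ p i → IsCongruence.reflexive (cψs i) (p i)
    ; sym        = λ t i → IsCongruence.sym (cψs i) (t i)
    ; trans      = λ t s i → IsCongruence.trans (cψs i) (t i) (s i)
    ; compatible = λ f ps i → IsCongruence.compatible (cψs i) f (λ k → ps k i)
    }

  inject : (i : Fin n) → Algebra.Carrier (A i) → Algebra.Carrier P
  inject i c = update e i c

  inject-at : ∀ i c → Algebra._≈_ (A i) (inject i c i) c
  inject-at i c = ≡⇒≈ (A i) (update-same e i c)

  inject-related : ∀ {ψs} → (∀ j → IsCongruence (A j) (ψs j)) →
                   ∀ i {c d} → ψs i c d → prod ψs (inject i c) (inject i d)
  inject-related {ψs} cψs i = update-related ψs e i (λ j → IsCongruence.reflexive (cψs j) (Eq.refl j))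

  inject-op : ∀ i f (cs : Fin (arity f) → Algebra.Carrier (A i)) →
              ker i (inject i (Algebra.op (A i) f cs)) (Algebra.op P f (λ k → inject i (cs k)))
  inject-op i f cs =
    Eq.trans i (inject-at i _) (Algebra.op-cong (A i) f (λ k → Eq.sym i (inject-at i (cs k))))

  inject-reflects : ∀ {i ψ} → IsCongruence (A i) ψ →
                    ∀ {c d} → lift i ψ (inject i c) (inject i d) → ψ c d
  inject-reflects {i} cψ t = trans (reflexive (Eq.sym i (inject-at i _))) (trans t (reflexive (inject-at i _)))
    where open IsCongruence cψ

  inject-preserves : ∀ {i ψ} → IsCongruence (A i) ψ →
                     ∀ {c d} → ψ c d → lift i ψ (inject i c) (inject i d)
  inject-preserves {i} cψ t = trans (reflexive (inject-at i _)) (trans t (reflexive (Eq.sym i (inject-at i _))))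
    where open IsCongruence cψ

  restrict : BRel P → (i : Fin n) → BRel (A i)
  restrict θ i c d = _∨_ P θ (ker i) (inject i c) (inject i d)

  inject-restrict : ∀ {θ} i {c d} → θ (inject i c) (inject i d) → restrict θ i c d
  inject-restrict i t = base (inj₁ t)

  -- θ ∨ ker i only depends on the ker i-classes of its arguments, so it
  -- relates x and y exactly when restrict θ i relates x i and y i.
  ∨ker-resp : ∀ {θ} i {x x′ y y′} → ker i x′ x → ker i y y′ →
              _∨_ P θ (ker i) x y → _∨_ P θ (ker i) x′ y′
  ∨ker-resp i kx ky p = tran (base (inj₂ kx)) (tran p (base (inj₂ ky)))

  restrict-at⁺ : ∀ {θ} i {x y} → _∨_ P θ (ker i) x y → restrict θ i (x i) (y i)
  restrict-at⁺ i = ∨ker-resp i (inject-at i _) (Eq.sym i (inject-at i _))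

  restrict-at⁻ : ∀ {θ} i {x y} → restrict θ i (x i) (y i) → _∨_ P θ (ker i) x y
  restrict-at⁻ i = ∨ker-resp i (Eq.sym i (inject-at i _)) (inject-at i _)

  restrict-isCongruence : ∀ θ i → IsCongruence (A i) (restrict θ i)
  restrict-isCongruence θ i = record
    { reflexive  = λ p → eq (inject-related (λ j → Δ-isCongruence (A j)) i p)
    ; sym        = symm
    ; trans      = tran
    ; compatible = λ f {cs} {ds} ps →
        ∨ker-resp i (inject-op i f cs) (Eq.sym i (inject-op i f ds)) (comp f ps)
    }

  restrict-unit : ∀ {θ} i → _⊆_ P θ (lift i (restrict θ i))
  restrict-unit i t = restrict-at⁺ i (base (inj₁ t))

  restrict-least : ∀ {θ} i {ψ} → IsCongruence (A i) ψ → _⊆_ P θ (lift i ψ) → _⊆_ (A i) (restrict θ i) ψ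
  restrict-least i cψ θ⊆ψ p =
    inject-reflects cψ (∨-least P (lift-isCongruence i cψ) θ⊆ψ (IsCongruence.reflexive cψ) p)

  restrict-mono : ∀ {θ θ′} i → _⊆_ P θ θ′ → _⊆_ (A i) (restrict θ i) (restrict θ′ i)
  restrict-mono i θ⊆θ′ = ∨-mono P θ⊆θ′ (λ k → k)

  restrict-lift : ∀ i {ψ} → IsCongruence (A i) ψ → _⊆_ (A i) ψ (restrict (lift i ψ) i)
  restrict-lift i cψ t = inject-restrict i (inject-preserves cψ t)

  restrict-prod : ∀ {ψs} → (∀ j → IsCongruence (A j) (ψs j)) → ∀ i →
                  _⊆_ (A i) (ψs i) (restrict (prod ψs) i)
  restrict-prod cψs i t = inject-restrict i (inject-related cψs i t)

  restrict-∨ : ∀ {α β} i → _⊆_ (A i) (restrict (_∨_ P α β) i) (_∨_ (A i) (restrict α i) (restrict β i))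
  restrict-∨ i = restrict-least i (Cg-isCongruence (A i) _)
    (∨-least P (lift-isCongruence i (Cg-isCongruence (A i) _))
      (λ t → base (inj₁ (restrict-unit i t))) (λ t → base (inj₂ (restrict-unit i t))))

  lift-proper : ∀ i {ψ} → IsCongruence (A i) ψ → Proper (A i) ψ → Proper P (lift i ψ)
  lift-proper i cψ ψ-proper ∇⊆lift =
    ψ-proper (λ {c} {d} _ → inject-reflects cψ (∇⊆lift {inject i c} {inject i d} tt))

  lift-maximal : ∀ i {M} → IsMaximal (A i) M → IsMaximal P (lift i M)
  lift-maximal i {M} (cM , M-proper , M-maximal) =
    lift-isCongruence i cM , lift-proper i cM M-proper , maximal
    where
    maximal : (ψ : BRel P) → IsCongruence P ψ → _⊆_ P (lift i M) ψ → Proper P ψ → _⊆_ P ψ (lift i M)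
    maximal ψ cψ M⊆ψ ψ-proper t = M⊆restrictψ⊆M (restrict-unit i t)
      where
      ker⊆ψ : _⊆_ P (ker i) ψ
      ker⊆ψ k = M⊆ψ (IsCongruence.reflexive cM k)
      restrictψ-proper : Proper (A i) (restrict ψ i)
      restrictψ-proper ∇⊆ = ψ-proper (λ _ → ∨-least P cψ (λ s → s) ker⊆ψ (restrict-at⁻ i (∇⊆ tt)))
      M⊆restrictψ⊆M : _⊆_ (A i) (restrict ψ i) M
      M⊆restrictψ⊆M = M-maximal (restrict ψ i) (restrict-isCongruence ψ i)
        (λ m → restrict-mono i M⊆ψ (restrict-lift i cM m)) restrictψ-proper

  restrict-maximal : ∀ i {M} → IsMaximal P M → Proper (A i) (restrict M i) → IsMaximal (A i) (restrict M i)
  restrict-maximal i {M} (cM , _ , M-maximal) restrict-proper =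
    restrict-isCongruence M i , restrict-proper , maximal
    where
    maximal : (ψ : BRel (A i)) → IsCongruence (A i) ψ → _⊆_ (A i) (restrict M i) ψ → Proper (A i) ψ →
              _⊆_ (A i) ψ (restrict M i)
    maximal ψ cψ M⊆ψ ψ-proper t =
      inject-restrict i (M-maximal (lift i ψ) (lift-isCongruence i cψ) (λ m → M⊆ψ (restrict-unit i m))
        (lift-proper i cψ ψ-proper) (inject-preserves cψ t))

  -- Elements of the radical of A i lie in every restriction of a maximal
  -- congruence of P, up to double negation (the restriction is maximal
  -- unless it is total).
  Rad-restrict-maximal : ∀ i {M} → IsMaximal P M → ∀ {c d} → Rad (A i) c d → ¬ ¬ restrict M i c d
  Rad-restrict-maximal i mM r ¬Mcd = ¬Mcd (r _ (restrict-maximal i mM (λ ∇⊆ → ¬Mcd (∇⊆ tt))))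

  Rad-restrict : ∀ i {α} → (∀ {x y} → α x y → Rad P x y) → ∀ {c d} → restrict α i c d → Rad (A i) c d
  Rad-restrict i α⊆Rad p M mM = restrict-least i (proj₁ mM) (λ t → α⊆Rad t (lift i M) (lift-maximal i mM)) p

  -- Restrictions of finitely generated congruences are finitely generated,
  -- by the coordinates of the generators.
  FinGen-restrict : ∀ i {α} → FinGen P α → FinGen (A i) (restrict α i)
  FinGen-restrict i {α} (ps , α⊆ , α⊇) = coordinates , G⊇ , G⊆
    where
    coordinates : List (Algebra.Carrier (A i) × Algebra.Carrier (A i))
    coordinates = map (λ (x , y) → x i , y i) ps
    G : BRel (A i)
    G = Cg (A i) (λ c d → (c , d) ∈ coordinates)
    G⊇ : _⊆_ (A i) (restrict α i) G
    G⊇ = restrict-least i (Cg-isCongruence (A i) _)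
      (λ t → Cg-least P (lift-isCongruence i (Cg-isCongruence (A i) _)) (λ m → base (∈-map⁺ _ m)) (α⊆ t))
    generator : ∀ {c d} → (c , d) ∈ coordinates → restrict α i c d
    generator m with ∈-map⁻ _ m
    ... | _ , m′ , refl = restrict-unit i (α⊇ (base m′))
    G⊆ : _⊆_ (A i) G (restrict α i)
    G⊆ = Cg-least (A i) (restrict-isCongruence α i) generator

  -- Under congruence distributivity every congruence θ of P is the
  -- product of its restrictions, because
  -- ⋀ᵢ (θ ∨ ker i) = θ ∨ ⋀ᵢ ker i = θ ∨ Δ = θ.
  module Distributive (cd : CongruenceDistributive P) where
    open Congruences.Distributive P cd using (∨-distribˡ-⋀)

    decompose : ∀ {θ} → IsCongruence P θ → _⊆_ P (prod (restrict θ)) θ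
    decompose {θ} cθ p =
      ∨-least P cθ (λ t → t) ⋀ker⊆θ
        (∨-distribˡ-⋀ cθ (λ i → lift-isCongruence i (Δ-isCongruence (A i))) (allFin n)
          (λ i _ → restrict-at⁻ i (p i)))
      where
      ⋀ker⊆θ : _⊆_ P (Congruences.⋀ P ker (allFin n)) θ
      ⋀ker⊆θ k = IsCongruence.reflexive cθ (λ i → k i (∈-allFin i))

    restrict-inject : ∀ {θ} → IsCongruence P θ → ∀ i {c d} → restrict θ i c d → θ (inject i c) (inject i d)
    restrict-inject {θ} cθ i p = decompose cθ (inject-related (λ j → restrict-isCongruence θ j) i p)

    prod-∨ : ∀ {ψs χs} → (∀ i → IsCongruence (A i) (ψs i)) → (∀ i → IsCongruence (A i) (χs i)) →
             _⊆_ P (prod (λ i → _∨_ (A i) (ψs i) (χs i))) (_∨_ P (prod ψs) (prod χs))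
    prod-∨ cψs cχs t = decompose (Cg-isCongruence P _) (λ i →
      ∨-least (A i) (restrict-isCongruence _ i)
        (λ s → restrict-mono i (λ u → base (inj₁ u)) (restrict-prod cψs i s))
        (λ s → restrict-mono i (λ u → base (inj₂ u)) (restrict-prod cχs i s))
        (t i))

    -- With ∇ compact: a product of congruences below the radicals is below
    -- the radical, since each maximal M of P is the product of its
    -- restrictions and these contain the radicals (up to ¬¬).
    Rad-prod : Compact P (∇ P) → ∀ {αs} → (∀ i {c d} → αs i c d → Rad (A i) c d) →
               ∀ {x y} → prod αs x y → Rad P x y
    Rad-prod compact αs⊆Rad t M mM =
      maximal-¬¬-stable mM
        (¬¬-map (decompose (proj₁ mM)) (¬¬-∀Fin (λ i → Rad-restrict-maximal i mM (αs⊆Rad i (t i)))))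
      where open Congruences.Compactness P compact

    Boolean-restrict : ∀ i {β} → InBooleanCenter P β → InBooleanCenter (A i) (restrict β i)
    Boolean-restrict i {β} (cβ , γ , cγ , (β∧γ⊆Δ , _) , (_ , ∇⊆β∨γ)) =
      restrict-isCongruence β i , restrict γ i , restrict-isCongruence γ i ,
      ( (λ (s , t) → inject-reflects (Δ-isCongruence (A i))
                       (β∧γ⊆Δ (restrict-inject cβ i s , restrict-inject cγ i t) i))
      , IsCongruence.reflexive (∧-isCongruence (A i) (restrict-isCongruence β i) (restrict-isCongruence γ i)) ) ,
      ( (λ _ → tt)
      , (λ {c} {d} _ → restrict-∨ i (inject-restrict i (∇⊆β∨γ {inject i c} {inject i d} tt))) )

    Boolean-prod : ∀ {βs} → (∀ i → InBooleanCenter (A i) (βs i)) → InBooleanCenter P (prod βs)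
    Boolean-prod {βs} central =
      prod-isCongruence cβs , prod γs , prod-isCongruence cγs ,
      ( (λ (s , t) i → proj₁ (β∧γ≐Δ i) (s i , t i))
      , IsCongruence.reflexive (∧-isCongruence P (prod-isCongruence cβs) (prod-isCongruence cγs)) ) ,
      ( (λ _ → tt) , (λ _ → prod-∨ cβs cγs (λ i → proj₂ (β∨γ≐∇ i) tt)) )
      where
      cβs : ∀ i → IsCongruence (A i) (βs i)
      cβs i = proj₁ (central i)
      γs : ∀ i → BRel (A i)
      γs i = proj₁ (proj₂ (central i))
      cγs : ∀ i → IsCongruence (A i) (γs i)
      cγs i = proj₁ (proj₂ (proj₂ (central i)))
      β∧γ≐Δ : ∀ i → _≐_ (A i) (_∧_ (A i) (βs i) (γs i)) (Δ (A i))
      β∧γ≐Δ i = proj₁ (proj₂ (proj₂ (proj₂ (central i))))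
      β∨γ≐∇ : ∀ i → _≐_ (A i) (_∨_ (A i) (βs i) (γs i)) (∇ (A i))
      β∨γ≐∇ i = proj₂ (proj₂ (proj₂ (proj₂ (central i))))

    -- A product of finitely generated congruences is generated by the
    -- injected generators of all factors.
    FinGen-prod : ∀ {αs} → (∀ i → IsCongruence (A i) (αs i)) → (∀ i → FinGen (A i) (αs i)) →
                  FinGen P (prod αs)
    FinGen-prod {αs} cαs fg = generators , G⊇ , G⊆
      where
      inject-pair : ∀ i → Algebra.Carrier (A i) × Algebra.Carrier (A i) → Algebra.Carrier P × Algebra.Carrier P
      inject-pair i (c , d) = inject i c , inject i d
      generators : List (Algebra.Carrier P × Algebra.Carrier P)
      generators = concatMap (λ i → map (inject-pair i) (proj₁ (fg i))) (allFin n)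
      G : BRel P
      G = Cg P (λ x y → (x , y) ∈ generators)
      G⊇ : _⊆_ P (prod αs) G
      G⊇ t = decompose (Cg-isCongruence P _) (λ i →
        Cg-least (A i) (restrict-isCongruence G i)
          (λ m → inject-restrict i (base (∈-concatMap⁺ _ (lose (∈-allFin i) (∈-map⁺ (inject-pair i) m)))))
          (proj₁ (proj₂ (fg i)) (t i)))
      generator : ∀ {x y} → (x , y) ∈ generators → prod αs x y
      generator m with find (∈-concatMap⁻ _ {xs = allFin n} m)
      ... | i , _ , m′ with ∈-map⁻ (inject-pair i) m′
      ... | _ , m″ , refl = inject-related cαs i (proj₂ (proj₂ (fg i)) (base m″))
      G⊆ : _⊆_ P G (prod αs)
      G⊆ = Cg-least P (prod-isCongruence cαs) generator

    -- (⋆) passes to the factors: decompose the lift of θ in P and restrict.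
    Star-restrict : Star P → ∀ i → Star (A i)
    Star-restrict star i = Congruences.Star-intro (A i) restricted
      where
      restricted : ∀ {θ} → IsCongruence (A i) θ → Congruences.⋆-Decomposition (A i) θ
      restricted {θ} cθ = record
        { α = restrict α i ; β = restrict β i
        ; α-congruence = restrict-isCongruence α i
        ; α-finGen     = FinGen-restrict i α-finGen
        ; α-radical    = Rad-restrict i α-radical
        ; β-central    = Boolean-restrict i β-central
        ; θ≐α∨β        = (λ t → restrict-∨ i (restrict-mono i θ⊆α∨β (restrict-lift i cθ t)))
                       , ∨-least (A i) cθ (restrict-least i cθ (λ t → α∨β⊆θ (base (inj₁ t))))
                                          (restrict-least i cθ (λ t → α∨β⊆θ (base (inj₂ t))))
        }
        where
        open Congruences.⋆-Decomposition
               (Congruences.⋆-decomposition P star (lift-isCongruence i cθ))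
        θ⊆α∨β : _⊆_ P (lift i θ) (_∨_ P α β)
        θ⊆α∨β = proj₁ θ≐α∨β
        α∨β⊆θ : _⊆_ P (_∨_ P α β) (lift i θ)
        α∨β⊆θ = proj₂ θ≐α∨β

    -- (⋆) passes to the product: decompose each restriction of θ and take
    -- the products of the pieces.
    Star-prod : Compact P (∇ P) → (∀ i → Star (A i)) → Star P
    Star-prod compact star = Congruences.Star-intro P decomposed
      where
      decomposed : ∀ {θ} → IsCongruence P θ → Congruences.⋆-Decomposition P θ
      decomposed {θ} cθ = record
        { α = prod αs ; β = prod βs
        ; α-congruence = prod-isCongruence cαs
        ; α-finGen     = FinGen-prod cαs (λ i → ⋆-Decomposition.α-finGen (D i))
        ; α-radical    = Rad-prod compact (λ i → ⋆-Decomposition.α-radical (D i))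
        ; β-central    = Boolean-prod (λ i → ⋆-Decomposition.β-central (D i))
        ; θ≐α∨β        = (λ t → prod-∨ cαs cβs (λ i → proj₁ (θ≐ i) (restrict-unit i t)))
                       , ∨-least P cθ (λ t → decompose cθ (λ i → proj₂ (θ≐ i) (base (inj₁ (t i)))))
                                      (λ t → decompose cθ (λ i → proj₂ (θ≐ i) (base (inj₂ (t i)))))
        }
        where
        open Congruences using (⋆-Decomposition)
        D : ∀ i → ⋆-Decomposition (A i) (restrict θ i)
        D i = Congruences.⋆-decomposition (A i) (star i) (restrict-isCongruence θ i)
        αs βs : ∀ i → BRel (A i)
        αs i = ⋆-Decomposition.α (D i)
        βs i = ⋆-Decomposition.β (D i)
        cαs : ∀ i → IsCongruence (A i) (αs i)
        cαs i = ⋆-Decomposition.α-congruence (D i)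
        cβs : ∀ i → IsCongruence (A i) (βs i)
        cβs i = proj₁ (⋆-Decomposition.β-central (D i))
        θ≐ : ∀ i → _≐_ (A i) (restrict θ i) (_∨_ (A i) (αs i) (βs i))
        θ≐ i = ⋆-Decomposition.θ≐α∨β (D i)

-- Proposition 4.46.  Only the product itself needs to be distributive
-- with compact ∇.
proposition4p46 : (𝑆 : Signature) (E : Term 𝑆 → Term 𝑆 → Set) →
    ((A : Algebra 𝑆) → InClass E A → CongruenceDistributive A) →
    ((A : Algebra 𝑆) → InClass E A → NonEmpty A → Compact A (∇ A)) →
    (n : ℕ) → 1 ≤ n → (A : Fin n → Algebra 𝑆) →
    (∀ i → InClass E (A i)) → (∀ i → NonEmpty (A i)) →
    Star (Π A) ⇔ (∀ i → Star (A i))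
proposition4p46 𝑆 E distributive compact n _ A A∈E point =
  mk⇔ Star-restrict (Star-prod (compact (Π A) Π∈E point))
  where
  Π∈E : InClass E (Π A)
  Π∈E = Π-InClass E A A∈E
  open Product A point
  open Distributive (distributive (Π A) Π∈E)
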